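{- Let $S$ be a commutative unital ring of positive characteristic and let $\ell\in S$ satisfy: (1) $\ell-1$ is regular; (2) for all positive integers $m,n$, $\ell^m-1\mid \ell^n-1$ if and only if $m\mid n$; (3) $0_S$ is the only multiple of $\ell-1$ in the set $\{n\cdot 1_S: n\in\mathbb{Z}\}$. Then for every $y\in S$: (a) $y=\ell^n$ for some positive multiple $n$ of $\operatorname{char}(S)$ if and only if $y$ is a positive power of $\ell$ and $(\ell-1)^2\mid y-1$. (b) If moreover $\operatorname{char}(S)=p$ is prime, then $y=\ell^{p^k}$ for some $k\geq 1$ if and only if $y=\ell^n$ for some positive multiple $n$ of $p$, and for every positive power $y'$ of $\ell$ with $y'\neq\ell$ and $y'-1\mid y-1$, $y'$ is of the form $\ell^{n'}$ with $n'$ a positive multiple of $p$.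
   Context: An element $a$ is regular if $ab=ac$ implies $b=c$. -}

module Defs where

open import Algebra.Bundles using (CommutativeRing; Semiring)
import Algebra.Definitions.RawSemiring as RS
open import Data.Nat as ℕ using (ℕ; _<_; _≤_)
open import Data.Nat.Divisibility using () renaming (_∣_ to _∣ℕ_)
open import Data.Integer using (ℤ; +_; -[1+_])
open import Data.Product using (∃-syntax; _×_)

module RingNotions {c ℓ} (R : CommutativeRing c ℓ) where
  open CommutativeRing R
  open RS (Semiring.rawSemiring semiring) public using (_^_; _∣_) renaming (_×_ to _⋆_)

  Regular : Carrier → Set _
  Regular a = ∀ b d → a * b ≈ a * d → b ≈ d

  _·1 : ℤ → Carrier
  (+ n) ·1 = n ⋆ 1#
  -[1+ n ] ·1 = - (ℕ.suc n ⋆ 1#)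

  HasPosChar : ℕ → Set _
  HasPosChar p = (0 < p) × (p ⋆ 1# ≈ 0#) × (∀ m → 0 < m → m ⋆ 1# ≈ 0# → p ≤ m)

  PosPowerOf : Carrier → Carrier → Set _
  PosPowerOf l y = ∃[ n ] (0 < n) × (y ≈ l ^ n)

  PowerMultipleOf : Carrier → ℕ → Carrier → Set _
  PowerMultipleOf l p y = ∃[ n ] (0 < n) × (p ∣ℕ n) × (y ≈ l ^ n)

{-# OPTIONS --safe #-}
-- Write d = l - 1 and G n = 1 + l + ... + l^(n-1). Then l^n - 1 = d * G n, and G n ≡ n · 1
-- modulo d because every l^i ≡ 1. As d is regular, d² ∣ l^n - 1 iff d ∣ G n iff d ∣ n · 1,
-- which by (3) means n · 1 = 0, i.e. char S ∣ n; this is (a). By (2), n ↦ l^n is injective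
-- on positive n, and for y = l^n the positive powers y′ = l^m with y′ - 1 ∣ y - 1 are exactly
-- those with m ∣ n, y′ ≠ l meaning m ≠ 1. So (b) is the arithmetic fact that a positive
-- multiple n of the prime p is a power of p iff every divisor m > 1 of n is a multiple of p.
module Submission where

open import Defs
open import Algebra.Bundles using (CommutativeRing; CommutativeSemiring)
import Algebra.Definitions.RawSemiring as RawSemiringDefinitions
open import Data.Nat as ℕ using (ℕ; zero; suc; _<_; _≤_; z<s)
open import Data.Nat.Primality using (Prime; prime⇒nonZero)
open import Data.Nat.Divisibility using () renaming (_∣_ to _∣ℕ_)
open import Data.Integer using (ℤ; +_)
open import Data.Product using (∃-syntax; _×_; _,_; proj₁; proj₂)
open import Function.Bundles using (_⇔_; mk⇔; Equivalence)
open import Function.Related.Propositional using (equivalence; module EquationalReasoning)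
open import Relation.Nullary using (¬_; contradiction)
open import Relation.Binary.PropositionalEquality as ≡ using (_≡_; _≢_; ≢-sym)
open import Level using (_⊔_)

module PrimePowers where
  open import Data.Nat
  open import Data.Nat.Properties using (*-comm; m<m*n; <⇒≢)
  open import Data.Nat.Divisibility
  open import Data.Nat.Coprimality using (Coprime; coprime-divisor)
  open import Data.Nat.Induction using (<-wellFounded)
  open import Data.Nat.Primality using (prime⇒irreducible; prime⇒nonTrivial)
  open import Data.Sum using (inj₁; inj₂)
  open import Induction.WellFounded using (Acc; acc)
  open import Relation.Nullary using (yes; no)
  open ≡ using (refl; trans; cong)

  private variable m n p : ℕ

  prime∤⇒coprime : Prime p → p ∤ m → Coprime m p
  prime∤⇒coprime p-prime p∤m (d∣m , d∣p) with prime⇒irreducible p-prime d∣p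
  ... | inj₁ d≡1 = d≡1
  ... | inj₂ refl = contradiction d∣m p∤m

  ∣p^k∧>1⇒p∣ : Prime p → ∀ k → m ∣ p ^ k → 1 < m → p ∣ m
  ∣p^k∧>1⇒p∣ _ zero m∣1 m>1 = contradiction (≡.sym (∣1⇒≡1 m∣1)) (<⇒≢ m>1)
  ∣p^k∧>1⇒p∣ {p} {m} p-prime (suc k) m∣p^[1+k] m>1 with p ∣? m
  ... | yes p∣m = p∣m
  ... | no p∤m =
    ∣p^k∧>1⇒p∣ p-prime k (coprime-divisor (prime∤⇒coprime p-prime p∤m) m∣p^[1+k]) m>1

  p∣nontrivialDivisors⇒≡p^k : Prime p → 0 < n → p ∣ n →
    (∀ {m} → m ∣ n → 1 < m → p ∣ m) → ∃[ k ] 1 ≤ k × n ≡ p ^ k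
  p∣nontrivialDivisors⇒≡p^k {p} p-prime = go (<-wellFounded _)
    where
    1<p : 1 < p
    1<p = nonTrivial⇒n>1 p {{prime⇒nonTrivial p-prime}}
    go : ∀ {n} → Acc _<_ n → 0 < n → p ∣ n →
         (∀ {m} → m ∣ n → 1 < m → p ∣ m) → ∃[ k ] 1 ≤ k × n ≡ p ^ k
    go _ () (divides-refl zero) _
    go _ _ (divides-refl 1) _ = 1 , s≤s z≤n , *-comm 1 p
    go (acc smaller) _ (divides-refl q@(suc (suc _))) p∣divisors
      with j , _ , q≡p^j ← go (smaller (m<m*n q p 1<p)) z<s
                               (p∣divisors (m∣m*n p) (s≤s (s≤s z≤n)))
                               (λ m∣q → p∣divisors (∣-trans m∣q (m∣m*n p)))
      = suc j , s≤s z≤n , trans (cong (_* p) q≡p^j) (*-comm (p ^ j) p)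

open PrimePowers using (∣p^k∧>1⇒p∣; p∣nontrivialDivisors⇒≡p^k)

module GeometricSum {c ℓ} (R : CommutativeSemiring c ℓ) where
  open CommutativeSemiring R
  open RawSemiringDefinitions rawSemiring using (_^_) renaming (_×_ to _⋆_)
  open import Relation.Binary.Reasoning.Setoid setoid
  open import Algebra.Solver.Ring.NaturalCoefficients.Default R
    using (solve; _:=_; _:+_; _:*_; con)

  geometricSum : Carrier → ℕ → Carrier
  geometricSum x zero    = 0#
  geometricSum x (suc n) = 1# + x * geometricSum x n

  module _ {x d : Carrier} (x≈d+1 : x ≈ d + 1#) where

    ^≈d*geometricSum+1 : ∀ n → x ^ n ≈ d * geometricSum x n + 1#
    ^≈d*geometricSum+1 zero = sym (trans (+-congʳ (zeroʳ d)) (+-identityˡ 1#))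
    ^≈d*geometricSum+1 (suc n) = begin
      x * x ^ n                     ≈⟨ *-cong x≈d+1 (^≈d*geometricSum+1 n) ⟩
      (d + 1#) * (d * g + 1#)       ≈⟨ expand d g ⟩
      d * (1# + (d + 1#) * g) + 1#  ≈⟨ +-congʳ (*-congˡ (+-congˡ (*-congʳ x≈d+1))) ⟨
      d * (1# + x * g) + 1#         ∎
      where
      g = geometricSum x n
      expand : ∀ d g → (d + 1#) * (d * g + 1#) ≈ d * (1# + (d + 1#) * g) + 1#
      expand = solve 2 (λ d g → (d :+ con 1) :* (d :* g :+ con 1)
                              := d :* (con 1 :+ (d :+ con 1) :* g) :+ con 1) refl

    geometricSum≈⋆1+*d : ∀ n → ∃[ t ] geometricSum x n ≈ n ⋆ 1# + t * d
    geometricSum≈⋆1+*d zero = 0# , sym (trans (+-congˡ (zeroˡ d)) (+-identityʳ 0#))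
    geometricSum≈⋆1+*d (suc n) with t , g≈ ← geometricSum≈⋆1+*d n =
      k + t * (d + 1#) , (begin
        1# + x * geometricSum x n          ≈⟨ +-congˡ (*-cong x≈d+1 g≈) ⟩
        1# + (d + 1#) * (k + t * d)        ≈⟨ expand k t d ⟩
        (1# + k) + (k + t * (d + 1#)) * d  ∎)
      where
      k = n ⋆ 1#
      expand : ∀ k t d → 1# + (d + 1#) * (k + t * d) ≈ (1# + k) + (k + t * (d + 1#)) * d
      expand = solve 3 (λ k t d → con 1 :+ (d :+ con 1) :* (k :+ t :* d)
                                := (con 1 :+ k) :+ (k :+ t :* (d :+ con 1)) :* d) refl

module PowersMinusOne {c ℓ} (S : CommutativeRing c ℓ) where
  open CommutativeRing S
  open RingNotions S
  open GeometricSum commutativeSemiring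
  open import Relation.Binary.Reasoning.Setoid setoid
  open import Algebra.Properties.Group +-group using (//-rightDividesˡ; //-rightDividesʳ)
  open import Algebra.Properties.Ring ring using ([y-z]x≈yx-zx)
  open import Algebra.Properties.CommutativeSemigroup *-commutativeSemigroup using (x∙yz≈y∙xz)
  open import Algebra.Properties.CommutativeSemigroup.Divisibility *-commutativeSemigroup
    using (_,_; ∣-respʳ-≈; ∣-respˡ-≈; x∣y⇒zx∣zy)
  open import Algebra.Properties.Monoid.Divisibility *-monoid using (∣ʳ-reflexive)
  open import Algebra.Properties.Semiring.Divisibility semiring using (_∣0)
  open import Algebra.Properties.Monoid.Mult +-monoid using (×-homo-+)
  open import Algebra.Properties.Semiring.Mult semiring using (×1-homo-*)
  open import Algebra.Properties.Semiring.Exp semiring using (^-congʳ)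
  open import Data.Nat.Properties using (<⇒≱; <⇒≢; ≤∧≢⇒<; <-trans; m^n>0)
  open import Data.Nat.DivMod using (_%_; _/_; m%n<n; m≡m%n+[m/n]*n)
  open import Data.Nat.Divisibility using (divides-refl; m%n≡0⇒n∣m; n∣m*n; m∣m*n; ∣-antisym)

  private variable
    x : Carrier
    m n p : ℕ

  x≈[x-1]+1 : ∀ x → x ≈ (x - 1#) + 1#
  x≈[x-1]+1 x = sym (//-rightDividesˡ 1# x)

  ^-1≈[x-1]*geometricSum : ∀ x n → x ^ n - 1# ≈ (x - 1#) * geometricSum x n
  ^-1≈[x-1]*geometricSum x n = begin
    x ^ n - 1#                               ≈⟨ +-congʳ (^≈d*geometricSum+1 (x≈[x-1]+1 x) n) ⟩
    ((x - 1#) * geometricSum x n + 1#) - 1#  ≈⟨ //-rightDividesʳ 1# _ ⟩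
    (x - 1#) * geometricSum x n              ∎

  ∣-respʳ-⇔ : ∀ {a b b′} → b ≈ b′ → (a ∣ b ⇔ a ∣ b′)
  ∣-respʳ-⇔ b≈b′ = mk⇔ (∣-respʳ-≈ b≈b′) (∣-respʳ-≈ (sym b≈b′))

  ∣+*⇔∣ : ∀ {a b} c → (a ∣ b + c * a ⇔ a ∣ b)
  ∣+*⇔∣ {a} {b} c = mk⇔
    (λ (q , q*a≈b+c*a) → q - c , (begin
      (q - c) * a          ≈⟨ [y-z]x≈yx-zx a q c ⟩
      q * a - c * a        ≈⟨ +-congʳ q*a≈b+c*a ⟩
      (b + c * a) - c * a  ≈⟨ //-rightDividesʳ (c * a) b ⟩
      b                    ∎))
    (λ (q , q*a≈b) → q + c , trans (distribʳ a q c) (+-congʳ q*a≈b))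

  regular⇒*-cancelˡ-∣ : ∀ {a b b′} → Regular a → (a * b ∣ a * b′ ⇔ b ∣ b′)
  regular⇒*-cancelˡ-∣ {a} {b} {b′} a-regular = mk⇔
    (λ (q , q*[a*b]≈a*b′) → q , a-regular (q * b) b′ (trans (x∙yz≈y∙xz a q b) q*[a*b]≈a*b′))
    (x∣y⇒zx∣zy a)

  [x-1]²∣x^n-1⇔[x-1]∣n⋆1 : Regular (x - 1#) → ∀ n →
    ((x - 1#) * (x - 1#) ∣ x ^ n - 1# ⇔ (x - 1#) ∣ n ⋆ 1#)
  [x-1]²∣x^n-1⇔[x-1]∣n⋆1 {x} regular n
    with t , geometricSum≈ ← geometricSum≈⋆1+*d (x≈[x-1]+1 x) n = ⇔.begin
      d * d ∣ x ^ n - 1#           ⇔.∼⟨ ∣-respʳ-⇔ (^-1≈[x-1]*geometricSum x n) ⟩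
      d * d ∣ d * geometricSum x n ⇔.∼⟨ regular⇒*-cancelˡ-∣ regular ⟩
      d ∣ geometricSum x n         ⇔.∼⟨ ∣-respʳ-⇔ geometricSum≈ ⟩
      d ∣ n ⋆ 1# + t * d           ⇔.∼⟨ ∣+*⇔∣ t ⟩
      d ∣ n ⋆ 1#                   ⇔.∎
    where
    module ⇔ = EquationalReasoning {k = equivalence}
    d = x - 1#

  module _ (char : HasPosChar p) where
    private instance
      p≢0 : ℕ.NonZero p
      p≢0 = ℕ.>-nonZero (proj₁ char)

    char∣⇒⋆1≈0 : p ∣ℕ n → n ⋆ 1# ≈ 0#
    char∣⇒⋆1≈0 (divides-refl q) = begin
      (q ℕ.* p) ⋆ 1#           ≈⟨ ×1-homo-* q p ⟩
      (q ⋆ 1#) * (p ⋆ 1#)      ≈⟨ *-congˡ (proj₁ (proj₂ char)) ⟩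
      (q ⋆ 1#) * 0#            ≈⟨ zeroʳ _ ⟩
      0#                       ∎

    ⋆1≈0∧<char⇒≡0 : n ⋆ 1# ≈ 0# → n < p → n ≡ 0
    ⋆1≈0∧<char⇒≡0 {zero} _ _ = ≡.refl
    ⋆1≈0∧<char⇒≡0 {suc n} n⋆1≈0 n<p = contradiction (proj₂ (proj₂ char) (suc n) z<s n⋆1≈0) (<⇒≱ n<p)

    ⋆1≈0⇒char∣ : n ⋆ 1# ≈ 0# → p ∣ℕ n
    ⋆1≈0⇒char∣ {n} n⋆1≈0 = m%n≡0⇒n∣m n p (⋆1≈0∧<char⇒≡0 remainder⋆1≈0 (m%n<n n p))
      where
      remainder⋆1≈0 : (n % p) ⋆ 1# ≈ 0#
      remainder⋆1≈0 = begin
        (n % p) ⋆ 1#                       ≈⟨ +-identityʳ _ ⟨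
        (n % p) ⋆ 1# + 0#                  ≈⟨ +-congˡ (char∣⇒⋆1≈0 (n∣m*n (n / p))) ⟨
        (n % p) ⋆ 1# + (n / p ℕ.* p) ⋆ 1#  ≈⟨ ×-homo-+ 1# (n % p) (n / p ℕ.* p) ⟨
        (n % p ℕ.+ n / p ℕ.* p) ⋆ 1#       ≡⟨ ≡.cong (_⋆ 1#) (m≡m%n+[m/n]*n n p) ⟨
        n ⋆ 1#                             ≈⟨ n⋆1≈0 ⟩
        0#                                 ∎

    ⋆1≈0⇔char∣ : n ⋆ 1# ≈ 0# ⇔ p ∣ℕ n
    ⋆1≈0⇔char∣ = mk⇔ ⋆1≈0⇒char∣ char∣⇒⋆1≈0

    powerMultipleOf⇔posPowerOf×[x-1]²∣y-1 : Regular (x - 1#) →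
      (∀ n → (x - 1#) ∣ n ⋆ 1# → n ⋆ 1# ≈ 0#) → ∀ y →
      (PowerMultipleOf x p y ⇔ (PosPowerOf x y × (x - 1#) * (x - 1#) ∣ y - 1#))
    powerMultipleOf⇔posPowerOf×[x-1]²∣y-1 {x} regular [x-1]∣⋆1⇒≈0 y = mk⇔
      (λ (n , n>0 , p∣n , y≈xⁿ) →
        (n , n>0 , y≈xⁿ) , ∣-respʳ-≈ (+-congʳ (sym y≈xⁿ)) (Equivalence.from (key n) p∣n))
      (λ ((n , n>0 , y≈xⁿ) , [x-1]²∣y-1) →
        n , n>0 , Equivalence.to (key n) (∣-respʳ-≈ (+-congʳ y≈xⁿ) [x-1]²∣y-1) , y≈xⁿ)
      where
      [x-1]∣⋆1⇔≈0 : ∀ n → ((x - 1#) ∣ n ⋆ 1# ⇔ n ⋆ 1# ≈ 0#)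
      [x-1]∣⋆1⇔≈0 n = mk⇔ ([x-1]∣⋆1⇒≈0 n) (λ n⋆1≈0 → ∣-respʳ-≈ (sym n⋆1≈0) ((x - 1#) ∣0))
      key : ∀ n → ((x - 1#) * (x - 1#) ∣ x ^ n - 1# ⇔ p ∣ℕ n)
      key n = ⇔.begin
        (x - 1#) * (x - 1#) ∣ x ^ n - 1#  ⇔.∼⟨ [x-1]²∣x^n-1⇔[x-1]∣n⋆1 regular n ⟩
        (x - 1#) ∣ n ⋆ 1#                 ⇔.∼⟨ [x-1]∣⋆1⇔≈0 n ⟩
        n ⋆ 1# ≈ 0#                       ⇔.∼⟨ ⋆1≈0⇔char∣ ⟩
        p ∣ℕ n                            ⇔.∎
        where module ⇔ = EquationalReasoning {k = equivalence}

  ReflectsDivisibility : Carrier → Set (c ⊔ ℓ)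
  ReflectsDivisibility x = ∀ m n → 0 < m → 0 < n → ((x ^ m - 1#) ∣ (x ^ n - 1#)) ⇔ (m ∣ℕ n)

  NontrivialPowerDivisorsMultipleOf : Carrier → ℕ → Carrier → Set (c ⊔ ℓ)
  NontrivialPowerDivisorsMultipleOf x p y =
    ∀ y′ → PosPowerOf x y′ → ¬ (y′ ≈ x) → (y′ - 1#) ∣ (y - 1#) → PowerMultipleOf x p y′

  module _ (reflects : ReflectsDivisibility x) where

    ^-injective : 0 < m → 0 < n → x ^ m ≈ x ^ n → m ≡ n
    ^-injective {m} {n} m>0 n>0 xᵐ≈xⁿ = ∣-antisym
      (Equivalence.to (reflects m n m>0 n>0) (∣ʳ-reflexive (+-congʳ xᵐ≈xⁿ)))
      (Equivalence.to (reflects n m n>0 m>0) (∣ʳ-reflexive (+-congʳ (sym xᵐ≈xⁿ))))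

    ^≉x⇔≢1 : 0 < m → ((¬ x ^ m ≈ x) ⇔ m ≢ 1)
    ^≉x⇔≢1 {m} m>0 = mk⇔
      (λ xᵐ≉x m≡1 → xᵐ≉x (trans (^-congʳ x m≡1) (*-identityʳ x)))
      (λ m≢1 xᵐ≈x → m≢1 (^-injective m>0 z<s (trans xᵐ≈x (sym (*-identityʳ x)))))

    nontrivialPowerDivisors⇔p∣nontrivialDivisors : ∀ {y} → 0 < n → y ≈ x ^ n →
      (NontrivialPowerDivisorsMultipleOf x p y ⇔ (∀ {m} → m ∣ℕ n → 1 < m → p ∣ℕ m))
    nontrivialPowerDivisors⇔p∣nontrivialDivisors {n} {p} {y} n>0 y≈xⁿ = mk⇔ to from
      where
      y-1≈xⁿ-1 : y - 1# ≈ x ^ n - 1#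
      y-1≈xⁿ-1 = +-congʳ y≈xⁿ
      to : NontrivialPowerDivisorsMultipleOf x p y → ∀ {m} → m ∣ℕ n → 1 < m → p ∣ℕ m
      to divisors {m} m∣n m>1 = p∣m (divisors (x ^ m) (m , m>0 , refl) xᵐ≉x xᵐ-1∣y-1)
        where
        m>0 = <-trans z<s m>1
        xᵐ≉x = Equivalence.from (^≉x⇔≢1 m>0) (≢-sym (<⇒≢ m>1))
        xᵐ-1∣y-1 = ∣-respʳ-≈ (sym y-1≈xⁿ-1) (Equivalence.from (reflects m n m>0 n>0) m∣n)
        p∣m : PowerMultipleOf x p (x ^ m) → p ∣ℕ m
        p∣m (n′ , n′>0 , p∣n′ , xᵐ≈xⁿ′) = ≡.subst (p ∣ℕ_) (≡.sym (^-injective m>0 n′>0 xᵐ≈xⁿ′)) p∣n′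
      from : (∀ {m} → m ∣ℕ n → 1 < m → p ∣ℕ m) → NontrivialPowerDivisorsMultipleOf x p y
      from p∣divisors y′ (m , m>0 , y′≈xᵐ) y′≉x y′-1∣y-1 = m , m>0 , p∣divisors m∣n m>1 , y′≈xᵐ
        where
        m∣n = Equivalence.to (reflects m n m>0 n>0)
                (∣-respʳ-≈ y-1≈xⁿ-1 (∣-respˡ-≈ (+-congʳ y′≈xᵐ) y′-1∣y-1))
        m>1 = ≤∧≢⇒< m>0 (≢-sym (Equivalence.to (^≉x⇔≢1 m>0) (λ xᵐ≈x → y′≉x (trans y′≈xᵐ xᵐ≈x))))

    ≈x^p^k⇔powerMultipleOf×nontrivialPowerDivisors : Prime p → ∀ y →
      ((∃[ k ] 1 ≤ k × y ≈ x ^ (p ℕ.^ k))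
       ⇔ (PowerMultipleOf x p y × NontrivialPowerDivisorsMultipleOf x p y))
    ≈x^p^k⇔powerMultipleOf×nontrivialPowerDivisors {p} p-prime y = mk⇔ to from
      where
      p^>0 : ∀ k → 0 < p ℕ.^ k
      p^>0 = m^n>0 p {{prime⇒nonZero p-prime}}
      to : ∃[ k ] 1 ≤ k × y ≈ x ^ (p ℕ.^ k) →
           PowerMultipleOf x p y × NontrivialPowerDivisorsMultipleOf x p y
      to (suc k , _ , y≈x^p^k) =
        (p ℕ.^ suc k , p^>0 (suc k) , m∣m*n (p ℕ.^ k) , y≈x^p^k) ,
        Equivalence.from (nontrivialPowerDivisors⇔p∣nontrivialDivisors (p^>0 (suc k)) y≈x^p^k)
          (∣p^k∧>1⇒p∣ p-prime (suc k))
      from : PowerMultipleOf x p y × NontrivialPowerDivisorsMultipleOf x p y →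
             ∃[ k ] 1 ≤ k × y ≈ x ^ (p ℕ.^ k)
      from ((n , n>0 , p∣n , y≈xⁿ) , divisors)
        with k , k≥1 , n≡p^k ← p∣nontrivialDivisors⇒≡p^k p-prime n>0 p∣n
               (Equivalence.to (nontrivialPowerDivisors⇔p∣nontrivialDivisors n>0 y≈xⁿ) divisors)
        = k , k≥1 , trans y≈xⁿ (^-congʳ x n≡p^k)

lemma2p1 : ∀ {c ℓ} (S : CommutativeRing c ℓ) →
  let open CommutativeRing S in let open RingNotions S in
  (p : ℕ) → HasPosChar p →
  (l : Carrier) →
  Regular (l - 1#) →
  (∀ m n → 0 < m → 0 < n → ((l ^ m - 1#) ∣ (l ^ n - 1#)) ⇔ (m ∣ℕ n)) →
  (∀ (z : ℤ) → (l - 1#) ∣ (z ·1) → z ·1 ≈ 0#) →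
  ∀ (y : Carrier) →
    (PowerMultipleOf l p y ⇔ (PosPowerOf l y × ((l - 1#) * (l - 1#)) ∣ (y - 1#)))
    × (Prime p →
        ((∃[ k ] (1 ≤ k) × (y ≈ l ^ (p ℕ.^ k)))
         ⇔ (PowerMultipleOf l p y
            × (∀ y′ → PosPowerOf l y′ → ¬ (y′ ≈ l) → (y′ - 1#) ∣ (y - 1#) →
                 PowerMultipleOf l p y′))))
lemma2p1 S p char l regular reflects [l-1]∣·1⇒≈0 y =
  powerMultipleOf⇔posPowerOf×[x-1]²∣y-1 char regular (λ n → [l-1]∣·1⇒≈0 (+ n)) y ,
  λ p-prime → ≈x^p^k⇔powerMultipleOf×nontrivialPowerDivisors reflects p-prime y
  where open PowersMinusOne S
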